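{- Let $P$ be a reverse semi-standard Young tableau and let $\rho^{ -1}(P)$ be the augmented filling constructed from $P$ as in the context. If $K$ is any semi-skyline augmented filling such that, for every $h\ge1$, the set of entries in row $h$ of $K$ equals the set of entries in row $h$ of $P$, then $K=\rho^{ -1}(P)$.
   Context: Diagrams are drawn French style: row $1$ of a partition shape is the bottom row. A reverse semi-standard Young tableau is a filling of the Young diagram of a partition with positive integers, strictly decreasing along rows (left to right) and weakly decreasing up columns (bottom to top). Weak compositions $\gamma=(\gamma_1,\gamma_2,\dots)$ have infinitely many parts, finitely many nonzero. The augmented diagram of $\gamma$ consists of the cells $(i,j)$, $i\ge1$, $0\le j\le\gamma_i$; row $0$ is the basement; column $i$ has height $\gamma_i$. An augmented filling $F$ assigns a positive integer to each cell, with $F(i,0)=i$ for all $i$. A descent is a pair of cells $(i,j+1),(i,j)$ with $F(i,j+1)>F(i,j)$. Let $I(x,y)=1$ if $x>y$ and $0$ otherwise. A type A triple consists of cells $a_1=(i_1,j)$, $a_2=(i_2,j)$, $a_3=(i_1,j-1)$ with $j\ge1$, $i_1<i_2$, $\gamma_{i_1}\ge\gamma_{i_2}$; it is an inversion triple if $I(F(a_1),F(a_2))+I(F(a_2),F(a_3))-I(F(a_1),F(a_3))=1$. A type B triple consists of cells $a_1=(i_1,j)$, $a_2=(i_2,j)$, $a_3=(i_2,j+1)$ with $j\ge0$, $i_1<i_2$, $\gamma_{i_2}>\gamma_{i_1}$; it is an inversion triple if $I(F(a_3),F(a_1))+I(F(a_1),F(a_2))-I(F(a_3),F(a_2))=1$.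 A semi-skyline augmented filling (SSAF) is an augmented filling with no descents in which every type A and type B triple is an inversion triple. Construction of $\rho^{ -1}(P)$: start with the basement only. For $h=1,2,\dots$, take the entries of row $h$ of $P$ in decreasing order; each entry $\alpha$ is placed in a new cell in row $h$ directly on top of the leftmost cell of row $h-1$ of the current filling whose entry is $\ge\alpha$ and whose cell directly above is still empty. -}

module Defs where

open import Data.Nat using (ℕ; zero; suc; _+_; _≤_; _<_; _≡ᵇ_; _≤ᵇ_; pred)
open import Data.Bool using (Bool; true; false; _∧_; if_then_else_)
open import Data.Maybe using (Maybe; just; nothing)
open import Data.List using (List; []; _∷_; map)
open import Data.Nat.ListAction using (sum)
open import Data.List.Relation.Unary.All using (All)
open import Data.List.Relation.Unary.Linked using (Linked)
open import Data.List.Membership.Propositional using (_∈_)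
open import Data.Product using (Σ; ∃; _×_)
open import Relation.Binary.PropositionalEquality using (_≡_)
open import Function.Bundles using (_⇔_)

-- Tableaux.  A tableau P is the list of its rows, row 1 (the bottom row,
-- French convention) first; each row is listed left to right.

-- ColDec r s : s can sit directly on top of r in a partition-shaped
-- diagram (length s ≤ length r) and entries weakly decrease going up.
data ColDec : List ℕ → List ℕ → Set where
  top-end : ∀ {r} → ColDec r []
  step    : ∀ {x y r s} → y ≤ x → ColDec r s → ColDec (x ∷ r) (y ∷ s)

StrictlyDecreasing : List ℕ → Set
StrictlyDecreasing = Linked (λ x y → y < x)

record IsReverseSSYT (P : List (List ℕ)) : Set where
  field
    positive  : All (All (λ x → 1 ≤ x)) P
    rowsDec   : All StrictlyDecreasing P
    colsDec   : Linked ColDec P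

rowOf : List (List ℕ) → ℕ → List ℕ
rowOf P zero = []
rowOf [] (suc h) = []
rowOf (r ∷ rs) (suc zero) = r
rowOf (r ∷ rs) (suc (suc h)) = rowOf rs (suc h)

-- Augmented fillings.  Columns are indexed by i ≥ 1 (index 0 is unused),
-- γ i is the height of column i, and F i j is the entry of cell (i,j)
-- (meaningful only for 0 ≤ j ≤ γ i).

record Filling : Set where
  constructor mkFilling
  field
    γ : ℕ → ℕ
    F : ℕ → ℕ → ℕ
open Filling public

I : ℕ → ℕ → ℕ
I x y = if y <ᵇ' x then 1 else 0
  where
  _<ᵇ'_ : ℕ → ℕ → Bool
  a <ᵇ' b = suc a ≤ᵇ b

record IsAugmentedFilling (K : Filling) : Set where
  field
    finiteSupport : ∃ λ N → ∀ i → N < i → γ K i ≡ 0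
    basement      : ∀ i → 1 ≤ i → F K i 0 ≡ i
    positive      : ∀ i j → 1 ≤ i → j ≤ γ K i → 1 ≤ F K i j

record IsSSAF (K : Filling) : Set where
  field
    augmented : IsAugmentedFilling K
    noDescent : ∀ i j → 1 ≤ i → suc j ≤ γ K i → F K i (suc j) ≤ F K i j
    -- type A triples a1=(i1,j), a2=(i2,j), a3=(i1,j-1); j ≥ 1,
    -- i1 < i2, γ i1 ≥ γ i2, all three cells in the diagram
    typeA : ∀ i₁ i₂ j → 1 ≤ i₁ → i₁ < i₂ → γ K i₂ ≤ γ K i₁ →
            1 ≤ j → j ≤ γ K i₂ →
            I (F K i₁ j) (F K i₂ j) + I (F K i₂ j) (F K i₁ (pred j))
              ≡ 1 + I (F K i₁ j) (F K i₁ (pred j))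
    -- type B triples a1=(i1,j), a2=(i2,j), a3=(i2,j+1); j ≥ 0,
    -- i1 < i2, γ i2 > γ i1, all three cells in the diagram
    typeB : ∀ i₁ i₂ j → 1 ≤ i₁ → i₁ < i₂ → γ K i₁ < γ K i₂ →
            j ≤ γ K i₁ →
            I (F K i₂ (suc j)) (F K i₁ j) + I (F K i₁ j) (F K i₂ j)
              ≡ 1 + I (F K i₂ (suc j)) (F K i₂ j)

InRow : Filling → ℕ → ℕ → Set
InRow K h x = ∃ λ i → 1 ≤ i × h ≤ γ K i × F K i h ≡ x

SameFilling : Filling → Filling → Set
SameFilling K K' =
  (∀ i → 1 ≤ i → γ K i ≡ γ K' i) ×
  (∀ i j → 1 ≤ i → j ≤ γ K i → F K i j ≡ F K' i j)

basementFilling : Filling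
basementFilling = mkFilling (λ _ → 0) base
  where
  base : ℕ → ℕ → ℕ
  base i zero = i
  base i (suc j) = 0

search : (ℕ → Bool) → ℕ → ℕ → Maybe ℕ
search p start zero = nothing
search p start (suc fuel) =
  if p start then just start else search p (suc start) fuel

place : ℕ → ℕ → ℕ → Filling → Filling
place h α i K = mkFilling γ' F'
  where
  γ' : ℕ → ℕ
  γ' k = if k ≡ᵇ i then h else γ K k
  F' : ℕ → ℕ → ℕ
  F' k j = if (k ≡ᵇ i) ∧ (j ≡ᵇ h) then α else F K k j

-- The search is over columns 1..B; B (the sum of
-- all entries of P) bounds every column that can ever be chosen.
insertOne : ℕ → ℕ → ℕ → Filling → Filling
insertOne B h α K with search (λ i → (γ K i ≡ᵇ pred h) ∧ (α ≤ᵇ F K i (pred h))) 1 B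
... | nothing = K
... | just i  = place h α i K

-- entries of a row in decreasing order (a row of a reverse SSYT is
-- already listed in decreasing order)
insertRow : ℕ → ℕ → List ℕ → Filling → Filling
insertRow B h [] K = K
insertRow B h (α ∷ as) K = insertRow B h as (insertOne B h α K)

insertRows : ℕ → ℕ → List (List ℕ) → Filling → Filling
insertRows B h [] K = K
insertRows B h (r ∷ rs) K = insertRows B (suc h) rs (insertRow B h r K)

ρ⁻¹ : List (List ℕ) → Filling
ρ⁻¹ P = insertRows (sum (map sum P)) 1 P basementFilling

-- The key property of an SSAF: if the entry of cell (c, m+1) is at most the
-- entry of (i, m) for some column i < c, then column i already has a cell in
-- row m+1, holding a strictly larger entry.  (If column i is at least as tall
-- as column c this is a type A triple; otherwise type B triples force column c
-- to stay strictly above column i all the way down to the basement, where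
-- F(i,0) = i < c = F(c,0).)  Since the entries of a row are inserted in
-- decreasing order and are pairwise distinct, every column left of the column
-- holding α in K is already blocked when α is inserted, so α lands exactly
-- where it sits in K.
module Submission where

open import Defs
open import Data.Nat using (ℕ; _≤_)
open import Data.List using (List)
open import Data.List.Membership.Propositional using (_∈_)
open import Function.Bundles using (_⇔_)

open import Data.Bool using (Bool; true; false; T; _∧_)
open import Data.Bool.Properties using (T-≡; T-∧)
open import Data.Empty using (⊥-elim)
open import Data.List using ([]; _∷_; map)
open import Data.List.Relation.Unary.All using (All; _∷_; lookup)
open import Data.List.Relation.Unary.AllPairs using (_∷_)
open import Data.List.Relation.Unary.Any using (here; there)
open import Data.List.Relation.Unary.Linked using ([]; tail)
open import Data.List.Relation.Unary.Linked.Properties using (Linked⇒AllPairs)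
open import Data.Maybe using (just)
open import Data.Nat using (zero; suc; _+_; _<_; _≡ᵇ_; _≤ᵇ_; pred; z≤n; s≤s; s≤s⁻¹)
open import Data.Nat.ListAction using (sum)
open import Data.Nat.Properties
open import Data.Product using (_×_; _,_; proj₁; proj₂)
open import Data.Sum using (inj₁; inj₂)
open import Function.Base using (_∘_)
open import Function.Bundles using (Equivalence)
open import Relation.Binary.Definitions using (tri<; tri≈; tri>)
open import Relation.Binary.PropositionalEquality
open import Relation.Nullary using (¬_; yes; no)

InversionTriple : ℕ → ℕ → ℕ → Set
InversionTriple x y z = I x y + I y z ≡ 1 + I x z

I-≤ : ∀ {x y} → x ≤ y → I x y ≡ 0
I-≤ {x} {y} x≤y with suc y ≤ᵇ x in eq
... | false = refl
... | true  = ⊥-elim (<⇒≱ (≤ᵇ⇒≤ (suc y) x (subst T (sym eq) _)) x≤y)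

inversion-≤⇒> : ∀ {x y z} → InversionTriple x y z → x ≤ y → z < y
inversion-≤⇒> {y = y} {z} inv x≤y with y ≤? z
... | no y≰z = ≰⇒> y≰z
... | yes y≤z with () ← subst₂ (λ a b → a + b ≡ _) (I-≤ x≤y) (I-≤ y≤z) inv

module SSAF-Properties {K : Filling} (S : IsSSAF K) where
  open IsSSAF S
  open IsAugmentedFilling augmented

  row-one-≤-column : ∀ {i} → 1 ≤ i → 1 ≤ γ K i → F K i 1 ≤ i
  row-one-≤-column {i} 1≤i 1≤γ =
    subst (F K i 1 ≤_) (basement i 1≤i) (noDescent i 0 1≤i 1≤γ)

  shorter-left⇒<-above : ∀ {i₁ i₂} → 1 ≤ i₁ → i₁ < i₂ → γ K i₁ < γ K i₂ →
                          ∀ j → j ≤ γ K i₁ → F K i₁ j < F K i₂ (suc j)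
  shorter-left⇒<-above {i₁} {i₂} 1≤i₁ i₁<i₂ γ₁<γ₂ j₀ j₀≤ = above j₀ j₀≤ (level j₀ j₀≤)
    where
    above : ∀ j → j ≤ γ K i₁ → F K i₁ j < F K i₂ j → F K i₁ j < F K i₂ (suc j)
    above j j≤ lt = ≰⇒> λ x≤y →
      <-asym lt (inversion-≤⇒> (typeB i₁ i₂ j 1≤i₁ i₁<i₂ γ₁<γ₂ j≤) x≤y)

    level : ∀ j → j ≤ γ K i₁ → F K i₁ j < F K i₂ j
    level zero _
      rewrite basement i₁ 1≤i₁ | basement i₂ (≤-trans 1≤i₁ (<⇒≤ i₁<i₂)) = i₁<i₂
    level (suc j) sj≤ = ≤-<-trans (noDescent i₁ j 1≤i₁ sj≤) (above j j≤ (level j j≤))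
      where
      j≤ : j ≤ γ K i₁
      j≤ = ≤-trans (n≤1+n j) sj≤

  fits-left⇒larger-left : ∀ {i₁ i₂} m → 1 ≤ i₁ → i₁ < i₂ → m ≤ γ K i₁ → suc m ≤ γ K i₂ →
                          F K i₂ (suc m) ≤ F K i₁ m →
                          suc m ≤ γ K i₁ × F K i₂ (suc m) < F K i₁ (suc m)
  fits-left⇒larger-left {i₁} {i₂} m 1≤i₁ i₁<i₂ m≤ sm≤ fits with γ K i₂ ≤? γ K i₁
  ... | no γ₂≰γ₁ = ⊥-elim (<⇒≱ (shorter-left⇒<-above 1≤i₁ i₁<i₂ (≰⇒> γ₂≰γ₁) m m≤) fits)
  ... | yes γ₂≤γ₁ = ≤-trans sm≤ γ₂≤γ₁ , ≰⇒> λ x≤y →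
        <⇒≱ (inversion-≤⇒> (typeA i₁ i₂ (suc m) 1≤i₁ i₁<i₂ γ₂≤γ₁ (s≤s z≤n) sm≤) x≤y) fits

  row-entries-differ : ∀ {i₁ i₂} m → 1 ≤ i₁ → i₁ < i₂ → suc m ≤ γ K i₁ → suc m ≤ γ K i₂ →
                       F K i₁ (suc m) ≢ F K i₂ (suc m)
  row-entries-differ {i₁} {i₂} m 1≤i₁ i₁<i₂ sm≤γ₁ sm≤γ₂ eq =
    <-irrefl (sym eq) (proj₂ (fits-left⇒larger-left m 1≤i₁ i₁<i₂ m≤γ₁ sm≤γ₂ fits))
    where
    m≤γ₁ : m ≤ γ K i₁
    m≤γ₁ = ≤-trans (n≤1+n m) sm≤γ₁
    fits : F K i₂ (suc m) ≤ F K i₁ m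
    fits = subst (_≤ F K i₁ m) eq (noDescent i₁ m 1≤i₁ sm≤γ₁)

  row-injective : ∀ {i₁ i₂} m → 1 ≤ i₁ → 1 ≤ i₂ → suc m ≤ γ K i₁ → suc m ≤ γ K i₂ →
                  F K i₁ (suc m) ≡ F K i₂ (suc m) → i₁ ≡ i₂
  row-injective {i₁} {i₂} m 1≤i₁ 1≤i₂ sm≤γ₁ sm≤γ₂ eq with <-cmp i₁ i₂
  ... | tri< lt _ _ = ⊥-elim (row-entries-differ m 1≤i₁ lt sm≤γ₁ sm≤γ₂ eq)
  ... | tri≈ _ e _  = e
  ... | tri> _ _ gt = ⊥-elim (row-entries-differ m 1≤i₂ gt sm≤γ₂ sm≤γ₁ (sym eq))

  row-one : ∀ c → 1 ≤ c → 1 ≤ γ K c → F K c 1 ≡ c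
  row-one c 1≤c 1≤γ = ≤-antisym (row-one-≤-column 1≤c 1≤γ) (≮⇒≥ λ α<c →
      let 1≤α = positive c 1 1≤c 1≤γ
          α-tall , α-larger = fits-left⇒larger-left 0 1≤α α<c z≤n 1≤γ
                                (≤-reflexive (sym (basement (F K c 1) 1≤α)))
      in <-irrefl refl (<-≤-trans α-larger (row-one-≤-column 1≤α α-tall)))

module _ {α : ℕ} {rest : List ℕ} (sd : StrictlyDecreasing (α ∷ rest)) where

  ∈tail⇒<head : ∀ {x} → x ∈ rest → x < α
  ∈tail⇒<head x∈ with Linked⇒AllPairs (λ y<x z<y → <-trans z<y y<x) sd
  ... | rest<α ∷ _ = lookup rest<α x∈

  ∈⇒≤head : ∀ {x} → x ∈ α ∷ rest → x ≤ α
  ∈⇒≤head (here refl) = ≤-refl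
  ∈⇒≤head (there x∈)  = <⇒≤ (∈tail⇒<head x∈)

∈⇒≤sum : ∀ {x xs} → x ∈ xs → x ≤ sum xs
∈⇒≤sum {xs = y ∷ ys} (here refl) = m≤m+n y (sum ys)
∈⇒≤sum {xs = y ∷ ys} (there x∈)  = ≤-trans (∈⇒≤sum x∈) (m≤n+m (sum ys) y)

∈rowOf⇒≤total : ∀ P h {x} → x ∈ rowOf P h → x ≤ sum (map sum P)
∈rowOf⇒≤total (r ∷ rs) (suc zero)    x∈ = ≤-trans (∈⇒≤sum x∈) (m≤m+n (sum r) _)
∈rowOf⇒≤total (r ∷ rs) (suc (suc h)) x∈ =
  ≤-trans (∈rowOf⇒≤total rs (suc h) x∈) (m≤n+m _ (sum r))

rowOf⁺ : ∀ {Q : List ℕ → Set} → Q [] → ∀ {P} → All Q P → ∀ h → Q (rowOf P h)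
rowOf⁺ q[] qs zero = q[]
rowOf⁺ q[] {[]} qs (suc h) = q[]
rowOf⁺ q[] (q ∷ qs) (suc zero) = q
rowOf⁺ q[] (q ∷ qs) (suc (suc h)) = rowOf⁺ q[] qs (suc h)

search-least : ∀ (p : ℕ → Bool) start fuel {c} → start ≤ c → c < start + fuel → T (p c) →
               (∀ i → start ≤ i → i < c → ¬ T (p i)) → search p start fuel ≡ just c
search-least p start zero s≤c c<s _ _ =
  ⊥-elim (<⇒≱ c<s (subst (_≤ _) (sym (+-identityʳ start)) s≤c))
search-least p start (suc fuel) {c} s≤c c<s pc least with m≤n⇒m<n∨m≡n s≤c
... | inj₂ refl rewrite Equivalence.to T-≡ pc = refl
... | inj₁ s<c with p start in eq
...   | true  = ⊥-elim (least start ≤-refl s<c (subst T (sym eq) _))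
...   | false = search-least p (suc start) fuel s<c (subst (c <_) (+-suc start fuel) c<s) pc
                  λ i s<i i<c → least i (<⇒≤ s<i) i<c

admissible : ℕ → ℕ → Filling → ℕ → Bool
admissible h α G i = (γ G i ≡ᵇ pred h) ∧ (α ≤ᵇ F G i (pred h))

admissible⁺ : ∀ {m α} G i → γ G i ≡ m → α ≤ F G i m → T (admissible (suc m) α G i)
admissible⁺ {m} {α} G i γ≡m α≤ =
  Equivalence.from T-∧ (≡⇒≡ᵇ (γ G i) m γ≡m , ≤⇒≤ᵇ α≤)

admissible⁻ : ∀ {m α} G i → T (admissible (suc m) α G i) → γ G i ≡ m × α ≤ F G i m
admissible⁻ {m} {α} G i adm with Equivalence.to T-∧ adm
... | γ≡m , α≤ = ≡ᵇ⇒≡ (γ G i) m γ≡m , ≤ᵇ⇒≤ α (F G i m) α≤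

insertOne-at : ∀ B h α G {c} → search (admissible h α G) 1 B ≡ just c →
               insertOne B h α G ≡ place h α c G
insertOne-at B h α G found rewrite found = refl

≡ᵇ-refl : ∀ n → (n ≡ᵇ n) ≡ true
≡ᵇ-refl n = Equivalence.to T-≡ (≡⇒≡ᵇ n n refl)

≢⇒≡ᵇ-false : ∀ {m n} → m ≢ n → (m ≡ᵇ n) ≡ false
≢⇒≡ᵇ-false {m} {n} m≢n with m ≡ᵇ n in eq
... | false = refl
... | true  = ⊥-elim (m≢n (≡ᵇ⇒≡ m n (subst T (sym eq) _)))

module Place (h α c : ℕ) (G : Filling) where

  place-γ-at : γ (place h α c G) c ≡ h
  place-γ-at rewrite ≡ᵇ-refl c = refl

  place-γ-other : ∀ {i} → i ≢ c → γ (place h α c G) i ≡ γ G i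
  place-γ-other i≢c rewrite ≢⇒≡ᵇ-false i≢c = refl

  place-F-at : F (place h α c G) c h ≡ α
  place-F-at rewrite ≡ᵇ-refl c | ≡ᵇ-refl h = refl

  place-F-other-column : ∀ {i j} → i ≢ c → F (place h α c G) i j ≡ F G i j
  place-F-other-column i≢c rewrite ≢⇒≡ᵇ-false i≢c = refl

  place-F-other-row : ∀ {j} → j ≢ h → F (place h α c G) c j ≡ F G c j
  place-F-other-row j≢h rewrite ≡ᵇ-refl c | ≢⇒≡ᵇ-false j≢h = refl

module Reconstruction (P : List (List ℕ)) (rowsDec : All StrictlyDecreasing P)
       (K : Filling) (S : IsSSAF K)
       (sameRows : ∀ h → 1 ≤ h → ∀ x → InRow K h x ⇔ x ∈ rowOf P h) where
  open IsSSAF S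
  open IsAugmentedFilling augmented
  open SSAF-Properties S

  B : ℕ
  B = sum (map sum P)

  entry∈row : ∀ m {i} → 1 ≤ i → suc m ≤ γ K i → F K i (suc m) ∈ rowOf P (suc m)
  entry∈row m {i} 1≤i sm≤γ =
    Equivalence.to (sameRows (suc m) (s≤s z≤n) _) (i , 1≤i , sm≤γ , refl)

  column≤B : ∀ {c} → 1 ≤ c → 1 ≤ γ K c → c ≤ B
  column≤B {c} 1≤c 1≤γ =
    subst (_≤ B) (row-one c 1≤c 1≤γ) (∈rowOf⇒≤total P 1 (entry∈row 0 1≤c 1≤γ))

  record Partial (m : ℕ) (pending : List ℕ) (G : Filling) : Set where
    field
      pending-height : ∀ i → 1 ≤ i → suc m ≤ γ K i → F K i (suc m) ∈ pending → γ G i ≡ m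
      placed-height  : ∀ i → 1 ≤ i → suc m ≤ γ K i → ¬ F K i (suc m) ∈ pending → γ G i ≡ suc m
      short-height   : ∀ i → 1 ≤ i → γ K i ≤ m → γ G i ≡ γ K i
      agrees         : ∀ i j → 1 ≤ i → j ≤ γ G i → F G i j ≡ F K i j

  height≡⇒≤ : ∀ {m pending G i} → Partial m pending G → 1 ≤ i → γ G i ≡ m → m ≤ γ K i
  height≡⇒≤ {m} {i = i} inv 1≤i γ≡m with γ K i ≤? m
  ... | yes γ≤m = ≤-reflexive (trans (sym γ≡m) (Partial.short-height inv i 1≤i γ≤m))
  ... | no γ≰m  = <⇒≤ (≰⇒> γ≰m)

  module Insert {m α rest G} (inv : Partial m (α ∷ rest) G) (sd : StrictlyDecreasing (α ∷ rest))
                {c} (1≤c : 1 ≤ c) (c-tall : suc m ≤ γ K c) (c-entry : F K c (suc m) ≡ α) where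
    open Partial inv
    open Place (suc m) α c G

    c-pending : γ G c ≡ m
    c-pending = pending-height c 1≤c c-tall (subst (_∈ α ∷ rest) (sym c-entry) (here refl))

    c-admissible : T (admissible (suc m) α G c)
    c-admissible = admissible⁺ G c c-pending (begin
      α              ≡⟨ sym c-entry ⟩
      F K c (suc m)  ≤⟨ noDescent c m 1≤c c-tall ⟩
      F K c m        ≡⟨ sym (agrees c m 1≤c (≤-reflexive (sym c-pending))) ⟩
      F G c m        ∎)
      where open ≤-Reasoning

    left-inadmissible : ∀ i → 1 ≤ i → i < c → ¬ T (admissible (suc m) α G i)
    left-inadmissible i 1≤i i<c adm =
      1+n≢n (trans (sym (placed-height i 1≤i i-tall i-placed)) γ≡m)
      where
      conditions : γ G i ≡ m × α ≤ F G i m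
      conditions = admissible⁻ G i adm
      γ≡m : γ G i ≡ m
      γ≡m = proj₁ conditions
      fits : F K c (suc m) ≤ F K i m
      fits = subst₂ _≤_ (sym c-entry) (agrees i m 1≤i (≤-reflexive (sym γ≡m))) (proj₂ conditions)
      larger : suc m ≤ γ K i × F K c (suc m) < F K i (suc m)
      larger = fits-left⇒larger-left m 1≤i i<c (height≡⇒≤ inv 1≤i γ≡m) c-tall fits
      i-tall : suc m ≤ γ K i
      i-tall = proj₁ larger
      i-placed : ¬ F K i (suc m) ∈ α ∷ rest
      i-placed x∈ = <⇒≱ (subst (_< F K i (suc m)) c-entry (proj₂ larger)) (∈⇒≤head sd x∈)

    inserts-at-c : insertOne B (suc m) α G ≡ place (suc m) α c G
    inserts-at-c = insertOne-at B (suc m) α G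
      (search-least _ 1 B 1≤c (s≤s (column≤B 1≤c (≤-trans (s≤s z≤n) c-tall)))
                    c-admissible left-inadmissible)

    placed : Partial m rest (place (suc m) α c G)
    Partial.pending-height placed i 1≤i sm≤γ x∈ with i ≟ c
    ... | yes refl = ⊥-elim (<-irrefl c-entry (∈tail⇒<head sd x∈))
    ... | no i≢c   = trans (place-γ-other i≢c) (pending-height i 1≤i sm≤γ (there x∈))
    Partial.placed-height placed i 1≤i sm≤γ x∉ with i ≟ c
    ... | yes refl = place-γ-at
    ... | no i≢c   = trans (place-γ-other i≢c) (placed-height i 1≤i sm≤γ λ where
          (here x≡α)  → i≢c (row-injective m 1≤i 1≤c sm≤γ c-tall (trans x≡α (sym c-entry)))
          (there x∈) → x∉ x∈)
    Partial.short-height placed i 1≤i γ≤m with i ≟ c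
    ... | yes refl = ⊥-elim (<⇒≱ c-tall γ≤m)
    ... | no i≢c   = trans (place-γ-other i≢c) (short-height i 1≤i γ≤m)
    Partial.agrees placed i j 1≤i j≤γ with i ≟ c | j ≟ suc m
    ... | no i≢c   | _         = trans (place-F-other-column i≢c)
                                   (agrees i j 1≤i (subst (j ≤_) (place-γ-other i≢c) j≤γ))
    ... | yes refl | yes refl  = trans place-F-at (sym c-entry)
    ... | yes refl | no j≢sm   = trans (place-F-other-row j≢sm) (agrees c j 1≤c j≤m)
      where
      j≤m : j ≤ γ G c
      j≤m = subst (j ≤_) (sym c-pending)
                  (s≤s⁻¹ (≤∧≢⇒< (subst (j ≤_) place-γ-at j≤γ) j≢sm))

  insertOne-Partial : ∀ {m α rest G} → Partial m (α ∷ rest) G → StrictlyDecreasing (α ∷ rest) →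
                      α ∈ rowOf P (suc m) → Partial m rest (insertOne B (suc m) α G)
  insertOne-Partial {m} {α} {rest} inv sd α∈ =
    let c , 1≤c , c-tall , c-entry = Equivalence.from (sameRows (suc m) (s≤s z≤n) α) α∈
        open Insert inv sd 1≤c c-tall c-entry
    in subst (Partial m rest) (sym inserts-at-c) placed

  insertRow-Partial : ∀ {m} pending {G} → Partial m pending G → StrictlyDecreasing pending →
                      (∀ {x} → x ∈ pending → x ∈ rowOf P (suc m)) →
                      Partial m [] (insertRow B (suc m) pending G)
  insertRow-Partial []             inv sd ⊆row = inv
  insertRow-Partial (α ∷ rest) inv sd ⊆row =
    insertRow-Partial rest (insertOne-Partial inv sd (⊆row (here refl))) (tail sd) (⊆row ∘ there)

  initial : Partial 0 (rowOf P 1) basementFilling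
  Partial.pending-height initial i 1≤i _ _   = refl
  Partial.placed-height  initial i 1≤i 1≤γ ∉ = ⊥-elim (∉ (entry∈row 0 1≤i 1≤γ))
  Partial.short-height   initial i 1≤i γ≤0   = sym (n≤0⇒n≡0 γ≤0)
  Partial.agrees         initial i zero 1≤i _ = sym (basement i 1≤i)

  next-row : ∀ {m G} → Partial m [] G → Partial (suc m) (rowOf P (suc (suc m))) G
  Partial.pending-height (next-row inv) i 1≤i ssm≤γ _ =
    Partial.placed-height inv i 1≤i (≤-trans (n≤1+n _) ssm≤γ) λ ()
  Partial.placed-height (next-row {m} inv) i 1≤i ssm≤γ ∉ =
    ⊥-elim (∉ (entry∈row (suc m) 1≤i ssm≤γ))
  Partial.short-height (next-row {m} inv) i 1≤i γ≤sm with m≤n⇒m<n∨m≡n γ≤sm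
  ... | inj₁ γ<sm = Partial.short-height inv i 1≤i (s≤s⁻¹ γ<sm)
  ... | inj₂ γ≡sm =
    trans (Partial.placed-height inv i 1≤i (≤-reflexive (sym γ≡sm)) λ ()) (sym γ≡sm)
  Partial.agrees (next-row inv) = Partial.agrees inv

  complete : ∀ {m G} → Partial m (rowOf P (suc m)) G → rowOf P (suc m) ≡ [] → SameFilling K G
  complete {m} {G} inv no-row = γ-same , λ i j 1≤i j≤γ →
    sym (Partial.agrees inv i j 1≤i (subst (j ≤_) (γ-same i 1≤i) j≤γ))
    where
    γ-same : ∀ i → 1 ≤ i → γ K i ≡ γ G i
    γ-same i 1≤i with γ K i ≤? m
    ... | yes γ≤m = sym (Partial.short-height inv i 1≤i γ≤m)
    ... | no γ≰m with () ← subst (F K i (suc m) ∈_) no-row (entry∈row m 1≤i (≰⇒> γ≰m))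

  insertRows-Partial : ∀ rs m G → Partial m (rowOf P (suc m)) G →
                       (∀ k → rowOf rs (suc k) ≡ rowOf P (suc (k + m))) →
                       SameFilling K (insertRows B (suc m) rs G)
  insertRows-Partial [] m G inv rs-suffix = complete inv (sym (rs-suffix 0))
  insertRows-Partial (r ∷ rs) m G inv rs-suffix =
    insertRows-Partial rs (suc m) (insertRow B (suc m) r G)
      (next-row (insertRow-Partial r (subst (λ pending → Partial m pending G) row≡r inv)
                   (subst StrictlyDecreasing row≡r (rowOf⁺ [] rowsDec (suc m)))
                   (subst (_ ∈_) (sym row≡r))))
      λ k → trans (rs-suffix (suc k)) (cong (rowOf P ∘ suc) (sym (+-suc k m)))
    where
    row≡r : rowOf P (suc m) ≡ r
    row≡r = sym (rs-suffix 0)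

  ρ⁻¹-reconstructs : SameFilling K (ρ⁻¹ P)
  ρ⁻¹-reconstructs = insertRows-Partial P 0 basementFilling initial
                       λ k → cong (rowOf P ∘ suc) (sym (+-identityʳ k))

lemma3p2 : (P : List (List ℕ)) → IsReverseSSYT P →
           (K : Filling) → IsSSAF K →
           (∀ h → 1 ≤ h → ∀ x → InRow K h x ⇔ x ∈ rowOf P h) →
           SameFilling K (ρ⁻¹ P)
lemma3p2 P tableau K ssaf sameRows =
  Reconstruction.ρ⁻¹-reconstructs P (IsReverseSSYT.rowsDec tableau) K ssaf sameRows
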